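{- Let $n,p$ be positive integers and $\kappa$ an $n,p$-core with conjugate $\kappa'$. Then $\mathrm{skl}(\kappa)=\mathrm{skl}(\kappa')$.
   Context: Partitions are identified with Young diagrams; $\lambda'$ is the conjugate ($(j,i)\in\lambda'$ iff $(i,j)\in\lambda$); hook length $h_\lambda(i,j)=\lambda_i-j+\lambda'_j-i+1$. An $n,p$-core has no hook length equal to $n$ or $p$ (the conjugate of an $n,p$-core is again one). For an $n,p$-core $\kappa$ with top-left hook length $m$, let $H^c(m)$ be the set of hook lengths of cells in the first column; the row whose leftmost cell has hook length $h\in H^c(m)$ is an $n$-row if $h+n\notin H^c(m)$. The skew length $\mathrm{skl}(\kappa)$ is the number of cells of $\kappa$ lying in an $n$-row and having hook length less than $p$. -}

module Defs where

open import Data.Nat using (ℕ; zero; suc; _+_; _∸_; _≤_; _<_; _≤?_; _<?_; _≟_)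
open import Data.List using (List; []; _∷_; length; map; filter; upTo)
open import Data.Nat.ListAction using (sum)
open import Data.List.Relation.Unary.All using (All)
open import Data.List.Relation.Unary.Linked using (Linked)
open import Data.List.Relation.Unary.Any using (any?)
open import Data.Product using (_×_)
open import Relation.Binary.PropositionalEquality using (_≡_; _≢_)
open import Relation.Nullary using (¬_; Dec; yes; no)
open import Relation.Nullary.Decidable using (¬?)
open import Data.Nat using (_≥_)

IsPartition : List ℕ → Set
IsPartition λs = Linked _≥_ λs × All (0 <_) λs

-- 1-indexed part λ_i (0 outside the range 1..length)
rowAt : List ℕ → ℕ → ℕ
rowAt []       _             = 0
rowAt (x ∷ xs) zero          = 0
rowAt (x ∷ xs) (suc zero)    = x
rowAt (x ∷ xs) (suc (suc i)) = rowAt xs (suc i)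

oneTo : ℕ → List ℕ
oneTo k = map suc (upTo k)

colAt : List ℕ → ℕ → ℕ
colAt λs j = length (filter (j ≤?_) λs)

conj : List ℕ → List ℕ
conj λs = map (colAt λs) (oneTo (rowAt λs 1))

InDiagram : List ℕ → ℕ → ℕ → Set
InDiagram λs i j = (1 ≤ i) × (i ≤ length λs) × (1 ≤ j) × (j ≤ rowAt λs i)

hook : List ℕ → ℕ → ℕ → ℕ
hook λs i j = (rowAt λs i ∸ j) + (colAt λs j ∸ i) + 1

IsCore : ℕ → ℕ → List ℕ → Set
IsCore n p λs = ∀ i j → InDiagram λs i j → (hook λs i j ≢ n) × (hook λs i j ≢ p)

firstColHooks : List ℕ → List ℕ
firstColHooks λs = map (λ i → hook λs i 1) (oneTo (length λs))

isNRow? : (n : ℕ) → (λs : List ℕ) → (i : ℕ) → Dec (¬ Data.List.Relation.Unary.Any.Any (λ h → h ≡ hook λs i 1 + n) (firstColHooks λs))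
isNRow? n λs i = ¬? (any? (λ h → h ≟ hook λs i 1 + n) (firstColHooks λs))

smallHooksInRow : ℕ → List ℕ → ℕ → ℕ
smallHooksInRow p λs i = length (filter (λ j → hook λs i j <? p) (oneTo (rowAt λs i)))

skl : ℕ → ℕ → List ℕ → ℕ
skl n p λs = sum (map (λ i → smallHooksInRow p λs i) (filter (isNRow? n λs) (oneTo (length λs))))

-- Let N be the hook length of the corner cell, H the set of first-column hooks and F the set
-- of first-row hooks (the first-column hooks of κ′).  A cell (i, j) satisfies
-- hook(i, j) + N = h_i + f_j, while h_i + f_j < N when (i, j) lies outside κ.  Counting then
-- shows that F is the complement of N − H in [0, N], and the n-core condition makes H closed
-- under x ↦ x − n.  So skl κ counts the pairs (x, y) ∈ H × F with N < x + y < N + p and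
-- x + n ∉ H, and skl κ′ those with y + n ∉ F.  The shift (x, y) ↦ (x + n, y − n) matches the
-- pairs with x + n ∈ H bijectively with those with y + n ∈ F, so both counts agree.
module Submission where

open import Data.Bool using (Bool; true; false; _∧_; not; T)
open import Data.Bool.Properties using (∧-zeroʳ; ∧-identityʳ; ∧-conicalˡ; ∧-conicalʳ; ⇔→≡; not-injective; ¬-not)
open import Data.Empty using (⊥; ⊥-elim)
open import Data.List using (List; []; _∷_; length; map; filter; applyUpTo)
open import Data.List.Properties using (map-∘; map-applyUpTo; length-applyUpTo; length-filter; filter-all; filter-none; filter-accept; filter-reject)
open import Data.List.Relation.Unary.All using (All; []; _∷_)
import Data.List.Relation.Unary.All as All
open import Data.List.Relation.Unary.All.Properties using (applyUpTo⁺₁)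
open import Data.List.Relation.Unary.AllPairs using (_∷_)
open import Data.List.Relation.Unary.Any using (any?)
open import Data.List.Relation.Unary.Linked using (Linked; []; [-]; _∷_; tail)
open import Data.List.Relation.Unary.Linked.Properties using (Linked⇒AllPairs)
open import Data.Nat
open import Data.Nat.ListAction using (sum)
open import Data.Nat.Properties
open import Data.Nat.Solver using (module +-*-Solver)
open import Algebra.Properties.CommutativeSemigroup +-commutativeSemigroup using (interchange; xy∙z≈xz∙y)
open import Data.Product using (∃; _×_; _,_; proj₁; proj₂)
open import Data.Unit using (tt)
open import Function using (_∘_; _$_)
open import Function.Bundles using (mk⇔)
open import Level using (0ℓ)
open import Relation.Binary.PropositionalEquality
open import Relation.Nullary using (¬_; Dec; does; yes; no; contradiction)
open import Relation.Nullary.Decidable using (dec-true; dec-false; does-⇔)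
open import Relation.Unary using (Pred; Decidable)
open import Defs

∑< : ℕ → (ℕ → ℕ) → ℕ
∑< zero    f = 0
∑< (suc K) f = f 0 + ∑< K (f ∘ suc)

syntax ∑< K (λ x → e) = ∑[ x < K ] e

𝟙 : Bool → ℕ
𝟙 true  = 1
𝟙 false = 0

𝟙-∧ : ∀ a b → 𝟙 (a ∧ b) ≡ 𝟙 a * 𝟙 b
𝟙-∧ false b = refl
𝟙-∧ true  b = sym (+-identityʳ (𝟙 b))

𝟙-≤1 : ∀ a → 𝟙 a ≤ 1
𝟙-≤1 false = z≤n
𝟙-≤1 true  = ≤-refl

∧-intro : ∀ {a b} → a ≡ true → b ≡ true → a ∧ b ≡ true
∧-intro refl refl = refl

does⇒ : ∀ {P : Set} (P? : Dec P) → does P? ≡ true → P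
does⇒ (yes p) _ = p

∑<-cong : ∀ K {f g : ℕ → ℕ} → (∀ x → x < K → f x ≡ g x) → ∑< K f ≡ ∑< K g
∑<-cong zero    f≡g = refl
∑<-cong (suc K) f≡g = cong₂ _+_ (f≡g 0 z<s) (∑<-cong K (λ x x<K → f≡g (suc x) (s<s x<K)))

∑<-vanishing : ∀ K {f : ℕ → ℕ} → (∀ x → x < K → f x ≡ 0) → ∑< K f ≡ 0
∑<-vanishing zero    f≡0 = refl
∑<-vanishing (suc K) f≡0 rewrite f≡0 0 z<s = ∑<-vanishing K (λ x x<K → f≡0 (suc x) (s<s x<K))

∑<-const-1 : ∀ K → ∑[ _ < K ] 1 ≡ K
∑<-const-1 zero    = refl
∑<-const-1 (suc K) = cong suc (∑<-const-1 K)

∑<-distrib-+ : ∀ K (f g : ℕ → ℕ) → ∑[ x < K ] (f x + g x) ≡ ∑< K f + ∑< K g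
∑<-distrib-+ zero    f g = refl
∑<-distrib-+ (suc K) f g =
  trans (cong (f 0 + g 0 +_) (∑<-distrib-+ K (f ∘ suc) (g ∘ suc))) (interchange (f 0) (g 0) _ _)

*-distribˡ-∑< : ∀ K c (f : ℕ → ℕ) → c * ∑< K f ≡ ∑[ x < K ] (c * f x)
*-distribˡ-∑< zero    c f = *-zeroʳ c
*-distribˡ-∑< (suc K) c f =
  trans (*-distribˡ-+ c (f 0) _) (cong (c * f 0 +_) (*-distribˡ-∑< K c (f ∘ suc)))

∑<-comm : ∀ A B (f : ℕ → ℕ → ℕ) → ∑[ x < A ] ∑[ y < B ] f x y ≡ ∑[ y < B ] ∑[ x < A ] f x y
∑<-comm zero    B f = sym (∑<-vanishing B (λ _ _ → refl))
∑<-comm (suc A) B f = begin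
  ∑[ y < B ] f 0 y + ∑[ x < A ] ∑[ y < B ] f (suc x) y   ≡⟨ cong (∑[ y < B ] f 0 y +_) (∑<-comm A B (f ∘ suc)) ⟩
  ∑[ y < B ] f 0 y + ∑[ y < B ] ∑[ x < A ] f (suc x) y   ≡⟨ ∑<-distrib-+ B (f 0) _ ⟨
  ∑[ y < B ] (f 0 y + ∑[ x < A ] f (suc x) y)             ∎
  where open ≡-Reasoning

∑<-+ : ∀ m k (f : ℕ → ℕ) → ∑< (m + k) f ≡ ∑< m f + ∑[ x < k ] f (m + x)
∑<-+ zero    k f = refl
∑<-+ (suc m) k f = trans (cong (f 0 +_) (∑<-+ m k (f ∘ suc))) (sym (+-assoc (f 0) _ _))

∑<-suc : ∀ K (f : ℕ → ℕ) → ∑< (suc K) f ≡ ∑< K f + f K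
∑<-suc zero    f = +-identityʳ (f 0)
∑<-suc (suc K) f = trans (cong (f 0 +_) (∑<-suc K (f ∘ suc))) (sym (+-assoc (f 0) _ _))

∑<-reverse : ∀ K (f : ℕ → ℕ) → ∑[ x < K ] f (K ∸ suc x) ≡ ∑< K f
∑<-reverse zero    f = refl
∑<-reverse (suc K) f = trans (cong (f K +_) (∑<-reverse K f)) (trans (+-comm (f K) _) (sym (∑<-suc K f)))

∑<-truncate : ∀ {K M} (f : ℕ → ℕ) → K ≤ M → (∀ x → K ≤ x → f x ≡ 0) → ∑< M f ≡ ∑< K f
∑<-truncate {K} f K≤M f≡0 with m≤n⇒∃[o]m+o≡n K≤M
... | k , refl = begin
  ∑< (K + k) f                     ≡⟨ ∑<-+ K k f ⟩
  ∑< K f + ∑[ x < k ] f (K + x)    ≡⟨ cong (∑< K f +_) (∑<-vanishing k (λ x _ → f≡0 (K + x) (m≤m+n K x))) ⟩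
  ∑< K f + 0                       ≡⟨ +-identityʳ _ ⟩
  ∑< K f                           ∎
  where open ≡-Reasoning

∑<-restrict : ∀ {m} M (f : ℕ → ℕ) → m ≤ M → ∑[ x < M ] (𝟙 (does (x <? m)) * f x) ≡ ∑< m f
∑<-restrict {m} M f m≤M = begin
  ∑[ x < M ] (𝟙 (does (x <? m)) * f x)   ≡⟨ ∑<-truncate _ m≤M (λ x m≤x → cong (λ b → 𝟙 b * f x) (dec-false (x <? m) (≤⇒≯ m≤x))) ⟩
  ∑[ x < m ] (𝟙 (does (x <? m)) * f x)   ≡⟨ ∑<-cong m (λ x x<m → trans (cong (λ b → 𝟙 b * f x) (dec-true (x <? m) x<m)) (+-identityʳ (f x))) ⟩
  ∑< m f                                 ∎
  where open ≡-Reasoning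

∑<-point : ∀ {K a} (f : ℕ → ℕ) → a < K → ∑[ x < K ] (𝟙 (does (a ≟ x)) * f x) ≡ f a
∑<-point {suc K} {zero}  f _         = trans (cong (f 0 + 0 +_) (∑<-vanishing K (λ _ _ → refl))) (trans (+-identityʳ _) (+-identityʳ (f 0)))
∑<-point {suc K} {suc a} f (s<s a<K) = ∑<-point (f ∘ suc) a<K

∑<-≤-bound : ∀ K (f : ℕ → ℕ) → (∀ x → x < K → f x ≤ 1) → ∑< K f ≤ K
∑<-≤-bound zero    f f≤1 = z≤n
∑<-≤-bound (suc K) f f≤1 = +-mono-≤ (f≤1 0 z<s) (∑<-≤-bound K (f ∘ suc) (λ x x<K → f≤1 (suc x) (s<s x<K)))

∑<≡bound⇒≡1 : ∀ K (f : ℕ → ℕ) → (∀ x → x < K → f x ≤ 1) → ∑< K f ≡ K → ∀ x → x < K → f x ≡ 1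
∑<≡bound⇒≡1 (suc K) f f≤1 ∑≡K x x<K = pointwise x x<K
  where
  f∘suc≤1 : ∀ x → x < K → f (suc x) ≤ 1
  f∘suc≤1 x x<K = f≤1 (suc x) (s<s x<K)
  rest≤K : ∑< K (f ∘ suc) ≤ K
  rest≤K = ∑<-≤-bound K (f ∘ suc) f∘suc≤1
  head≡1 : f 0 ≡ 1
  head≡1 = ≤-antisym (f≤1 0 z<s) (+-cancelʳ-≤ K 1 (f 0) (≤-trans (≤-reflexive (sym ∑≡K)) (+-monoʳ-≤ (f 0) rest≤K)))
  pointwise : ∀ x → x < suc K → f x ≡ 1
  pointwise zero    _         = head≡1
  pointwise (suc x) (s<s x<K) = ∑<≡bound⇒≡1 K (f ∘ suc) f∘suc≤1 (suc-injective (trans (cong (_+ ∑< K (f ∘ suc)) (sym head≡1)) ∑≡K)) x x<K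

∑<-shift : ∀ n K (g : ℕ → ℕ) → (∀ y → y < n → g y ≡ 0) → (∀ y → K ≤ y → g y ≡ 0) → ∑[ y < K ] g (n + y) ≡ ∑< K g
∑<-shift n K g below above = begin
  ∑[ y < K ] g (n + y)              ≡⟨ cong (_+ ∑[ y < K ] g (n + y)) (∑<-vanishing n below) ⟨
  ∑< n g + ∑[ y < K ] g (n + y)     ≡⟨ ∑<-+ n K g ⟨
  ∑< (n + K) g                      ≡⟨ ∑<-truncate g (m≤n+m K n) above ⟩
  ∑< K g                            ∎
  where open ≡-Reasoning

∑<-shift-up : ∀ n K (f : ℕ → ℕ) → (∀ x → K ∸ n ≤ x → f x ≡ 0) → ∑[ x < K ] (𝟙 (does (n ≤? x)) * f (x ∸ n)) ≡ ∑< K f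
∑<-shift-up n K f above = begin
  ∑[ x < K ] g x         ≡⟨ ∑<-shift n K g below (λ x K≤x → trans (cong (𝟙 (does (n ≤? x)) *_) (above (x ∸ n) (∸-monoˡ-≤ n K≤x))) (*-zeroʳ (𝟙 (does (n ≤? x))))) ⟨
  ∑[ y < K ] g (n + y)   ≡⟨ ∑<-cong K (λ y _ → cong₂ (λ b z → 𝟙 b * f z) (dec-true (n ≤? n + y) (m≤m+n n y)) (m+n∸m≡n n y)) ⟩
  ∑[ y < K ] (1 * f y)   ≡⟨ ∑<-cong K (λ y _ → *-identityˡ (f y)) ⟩
  ∑< K f                 ∎
  where
  open ≡-Reasoning
  g : ℕ → ℕ
  g x = 𝟙 (does (n ≤? x)) * f (x ∸ n)
  below : ∀ x → x < n → g x ≡ 0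
  below x x<n = cong (λ b → 𝟙 b * f (x ∸ n)) (dec-false (n ≤? x) (<⇒≱ x<n))

𝟙-∧-not+𝟙-∧ : ∀ a b → 𝟙 (a ∧ not b) + 𝟙 (a ∧ b) ≡ 𝟙 a
𝟙-∧-not+𝟙-∧ false b     = refl
𝟙-∧-not+𝟙-∧ true  false = refl
𝟙-∧-not+𝟙-∧ true  true  = refl

𝟙[a∧b]*𝟙[c∧d]≡𝟙[[a∧c∧d]∧b] : ∀ a b c d → 𝟙 (a ∧ b) * 𝟙 (c ∧ d) ≡ 𝟙 ((a ∧ c ∧ d) ∧ b)
𝟙[a∧b]*𝟙[c∧d]≡𝟙[[a∧c∧d]∧b] false b     c d = refl
𝟙[a∧b]*𝟙[c∧d]≡𝟙[[a∧c∧d]∧b] true  false c d = cong 𝟙 (sym (∧-zeroʳ (c ∧ d)))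
𝟙[a∧b]*𝟙[c∧d]≡𝟙[[a∧c∧d]∧b] true  true  c d = trans (+-identityʳ _) (cong 𝟙 (sym (∧-identityʳ (c ∧ d))))

𝟙[a∧b]*𝟙[c∧d]≡𝟙[[c∧a∧d]∧b] : ∀ a b c d → 𝟙 (a ∧ b) * 𝟙 (c ∧ d) ≡ 𝟙 ((c ∧ a ∧ d) ∧ b)
𝟙[a∧b]*𝟙[c∧d]≡𝟙[[c∧a∧d]∧b] a b false d = *-zeroʳ (𝟙 (a ∧ b))
𝟙[a∧b]*𝟙[c∧d]≡𝟙[[c∧a∧d]∧b] a b true  d = 𝟙[a∧b]*𝟙[c∧d]≡𝟙[[a∧c∧d]∧b] a b true d

𝟙+𝟙≡1⇒≡not : ∀ a b → 𝟙 a + 𝟙 b ≡ 1 → b ≡ not a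
𝟙+𝟙≡1⇒≡not false true  _ = refl
𝟙+𝟙≡1⇒≡not true  false _ = refl

𝟙+𝟙≤1 : ∀ a b → (a ≡ true → b ≡ true → ⊥) → 𝟙 a + 𝟙 b ≤ 1
𝟙+𝟙≤1 false b     _        = 𝟙-≤1 b
𝟙+𝟙≤1 true  false _        = ≤-refl
𝟙+𝟙≤1 true  true  disjoint = ⊥-elim (disjoint refl refl)

complement-by-counting : ∀ N (A B : ℕ → Bool) → (∀ x → x ≤ N → A x ≡ true → B (N ∸ x) ≡ true → ⊥) →
                         ∑[ x < suc N ] 𝟙 (A x) + ∑[ y < suc N ] 𝟙 (B y) ≡ suc N →
                         ∀ y → y ≤ N → B y ≡ not (A (N ∸ y))
complement-by-counting N A B disjoint total y y≤N =
  𝟙+𝟙≡1⇒≡not (A (N ∸ y)) (B y) (subst (λ z → 𝟙 (A (N ∸ y)) + 𝟙 (B z) ≡ 1) (m∸[m∸n]≡n y≤N)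
    (∑<≡bound⇒≡1 (suc N) t (λ x x<1+N → 𝟙+𝟙≤1 (A x) (B (N ∸ x)) (disjoint x (s≤s⁻¹ x<1+N))) ∑t≡1+N (N ∸ y) (s≤s (m∸n≤m N y))))
  where
  t : ℕ → ℕ
  t x = 𝟙 (A x) + 𝟙 (B (N ∸ x))
  ∑t≡1+N : ∑< (suc N) t ≡ suc N
  ∑t≡1+N = trans (∑<-distrib-+ (suc N) (𝟙 ∘ A) (λ x → 𝟙 (B (N ∸ x)))) (trans (cong (∑[ x < suc N ] 𝟙 (A x) +_) (∑<-reverse (suc N) (𝟙 ∘ B))) total)

𝟙*[𝟙*∑𝟙*𝟙]≡𝟙∧*∑𝟙∧ : ∀ K a b (c d : ℕ → Bool) →
                     𝟙 a * (𝟙 b * ∑[ y < K ] (𝟙 (c y) * 𝟙 (d y))) ≡ 𝟙 (a ∧ b) * ∑[ y < K ] 𝟙 (c y ∧ d y)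
𝟙*[𝟙*∑𝟙*𝟙]≡𝟙∧*∑𝟙∧ K a b c d = begin
  𝟙 a * (𝟙 b * ∑[ y < K ] (𝟙 (c y) * 𝟙 (d y)))   ≡⟨ *-assoc (𝟙 a) (𝟙 b) _ ⟨
  𝟙 a * 𝟙 b * ∑[ y < K ] (𝟙 (c y) * 𝟙 (d y))     ≡⟨ cong₂ _*_ (𝟙-∧ a b) (∑<-cong K (λ y _ → 𝟙-∧ (c y) (d y))) ⟨
  𝟙 (a ∧ b) * ∑[ y < K ] 𝟙 (c y ∧ d y)           ∎
  where open ≡-Reasoning

≡ᵇ-true⇒≡ : ∀ {m n} → (m ≡ᵇ n) ≡ true → m ≡ n
≡ᵇ-true⇒≡ {m} {n} m≡ᵇn = ≡ᵇ⇒≡ m n (subst T (sym m≡ᵇn) tt)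

_∈ᵇ_ : ℕ → List ℕ → Bool
y ∈ᵇ xs = does (any? (λ x → x ≟ y) xs)

length-filter≡sum-𝟙 : ∀ {P : Pred ℕ 0ℓ} (P? : Decidable P) xs → length (filter P? xs) ≡ sum (map (𝟙 ∘ does ∘ P?) xs)
length-filter≡sum-𝟙 P? []       = refl
length-filter≡sum-𝟙 P? (x ∷ xs) with does (P? x)
... | true  = cong suc (length-filter≡sum-𝟙 P? xs)
... | false = length-filter≡sum-𝟙 P? xs

sum-map-filter : ∀ {P : Pred ℕ 0ℓ} (P? : Decidable P) (f : ℕ → ℕ) xs →
                 sum (map f (filter P? xs)) ≡ sum (map (λ x → 𝟙 (does (P? x)) * f x) xs)
sum-map-filter P? f []       = refl
sum-map-filter P? f (x ∷ xs) with does (P? x)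
... | true  = cong₂ _+_ (sym (+-identityʳ (f x))) (sum-map-filter P? f xs)
... | false = sum-map-filter P? f xs

map-oneTo : ∀ (f : ℕ → ℕ) m → map f (oneTo m) ≡ applyUpTo (f ∘ suc) m
map-oneTo f m = trans (cong (map f) (map-applyUpTo (λ x → x) suc m)) (map-applyUpTo suc f m)

sum-applyUpTo : ∀ (f : ℕ → ℕ) m → sum (applyUpTo f m) ≡ ∑< m f
sum-applyUpTo f zero    = refl
sum-applyUpTo f (suc m) = cong (f 0 +_) (sum-applyUpTo (f ∘ suc) m)

rowAt-applyUpTo : ∀ (f : ℕ → ℕ) {m k} → k < m → rowAt (applyUpTo f m) (suc k) ≡ f k
rowAt-applyUpTo f {suc m} {zero}  _         = refl
rowAt-applyUpTo f {suc m} {suc k} (s<s k<m) = rowAt-applyUpTo (f ∘ suc) k<m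

applyUpTo-decreasing : ∀ (f : ℕ → ℕ) m → (∀ k → suc k < m → f (suc k) < f k) → Linked _>_ (applyUpTo f m)
applyUpTo-decreasing f zero          _    = []
applyUpTo-decreasing f (suc zero)    _    = [-]
applyUpTo-decreasing f (suc (suc m)) decr = decr 0 (s<s z<s) ∷ applyUpTo-decreasing (f ∘ suc) (suc m) (λ k k<m → decr (suc k) (s<s k<m))

∈ᵇ-applyUpTo⁻ : ∀ (f : ℕ → ℕ) m {y} → y ∈ᵇ applyUpTo f m ≡ true → ∃ λ k → k < m × f k ≡ y
∈ᵇ-applyUpTo⁻ f (suc m) {y} y∈ with f 0 ≡ᵇ y in f0≡ᵇy
... | true  = 0 , z<s , ≡ᵇ-true⇒≡ {f 0} f0≡ᵇy
... | false with ∈ᵇ-applyUpTo⁻ (f ∘ suc) m y∈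
...   | k , k<m , fk≡y = suc k , s<s k<m , fk≡y

∈ᵇ-above : ∀ {a} xs → All (_< a) xs → a ∈ᵇ xs ≡ false
∈ᵇ-above         []       []            = refl
∈ᵇ-above {a} (x ∷ xs) (x<a ∷ xs<a) rewrite dec-false (x ≟ a) (<⇒≢ x<a) = ∈ᵇ-above xs xs<a

∑<-∈ᵇ : ∀ K (φ : ℕ → ℕ) xs → Linked _>_ xs → All (_< K) xs → ∑[ x < K ] (𝟙 (x ∈ᵇ xs) * φ x) ≡ sum (map φ xs)
∑<-∈ᵇ K φ []       _ _            = ∑<-vanishing K λ _ _ → refl
∑<-∈ᵇ K φ (a ∷ xs) l (a<K ∷ xs<K) with Linked⇒AllPairs (λ x>y y>z → <-trans y>z x>y) l
... | xs<a ∷ _ = begin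
  ∑[ x < K ] (𝟙 (x ∈ᵇ (a ∷ xs)) * φ x)                                 ≡⟨ ∑<-cong K (λ x _ → split x) ⟩
  ∑[ x < K ] (𝟙 (does (a ≟ x)) * φ x + 𝟙 (x ∈ᵇ xs) * φ x)             ≡⟨ ∑<-distrib-+ K _ _ ⟩
  ∑[ x < K ] (𝟙 (does (a ≟ x)) * φ x) + ∑[ x < K ] (𝟙 (x ∈ᵇ xs) * φ x) ≡⟨ cong₂ _+_ (∑<-point φ a<K) (∑<-∈ᵇ K φ xs (tail l) xs<K) ⟩
  φ a + sum (map φ xs)                                                  ∎
  where
  open ≡-Reasoning
  split : ∀ x → 𝟙 (x ∈ᵇ (a ∷ xs)) * φ x ≡ 𝟙 (does (a ≟ x)) * φ x + 𝟙 (x ∈ᵇ xs) * φ x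
  split x with a ≡ᵇ x in a≡ᵇx
  ... | false = refl
  ... | true with refl ← ≡ᵇ-true⇒≡ {a} {x} a≡ᵇx rewrite ∈ᵇ-above xs xs<a = sym (+-identityʳ _)

applyUpTo-cong : ∀ {f g : ℕ → ℕ} m → (∀ k → k < m → f k ≡ g k) → applyUpTo f m ≡ applyUpTo g m
applyUpTo-cong zero    f≡g = refl
applyUpTo-cong (suc m) f≡g = cong₂ _∷_ (f≡g 0 z<s) (applyUpTo-cong m (λ k k<m → f≡g (suc k) (s<s k<m)))

∑<-∈ᵇ-applyUpTo : ∀ K (φ g : ℕ → ℕ) m → (∀ k → suc k < m → g (suc k) < g k) → (∀ k → k < m → g k < K) →
                  ∑[ x < K ] (𝟙 (x ∈ᵇ applyUpTo g m) * φ x) ≡ ∑[ k < m ] φ (g k)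
∑<-∈ᵇ-applyUpTo K φ g m decr g<K = begin
  ∑[ x < K ] (𝟙 (x ∈ᵇ applyUpTo g m) * φ x) ≡⟨ ∑<-∈ᵇ K φ (applyUpTo g m) (applyUpTo-decreasing g m decr) (applyUpTo⁺₁ g m (g<K _)) ⟩
  sum (map φ (applyUpTo g m))                 ≡⟨ cong sum (map-applyUpTo g φ m) ⟩
  sum (applyUpTo (φ ∘ g) m)                   ≡⟨ sum-applyUpTo (φ ∘ g) m ⟩
  ∑[ k < m ] φ (g k)                          ∎
  where open ≡-Reasoning

Decreasing : List ℕ → Set
Decreasing = Linked _≥_

head-≥-rest : ∀ {a κ} → Decreasing (a ∷ κ) → All (_≤ a) κ
head-≥-rest d with Linked⇒AllPairs (λ x≥y y≥z → ≤-trans y≥z x≥y) d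
... | κ≤a ∷ _ = κ≤a

rowAt-≤-head : ∀ {a κ} → Decreasing (a ∷ κ) → ∀ i → rowAt (a ∷ κ) i ≤ a
rowAt-≤-head {a} {κ} d zero = z≤n
rowAt-≤-head {a} {κ} d (suc zero) = ≤-refl
rowAt-≤-head {a} {[]} d (suc (suc i)) = z≤n
rowAt-≤-head {a} {b ∷ κ} (a≥b ∷ d) (suc (suc i)) = ≤-trans (rowAt-≤-head d (suc i)) a≥b

<rowAt⇒<colAt : ∀ {κ} → Decreasing κ → ∀ {i j} → j < rowAt κ (suc i) → i < colAt κ (suc j)
<rowAt⇒<colAt {a ∷ κ} d {zero} {j} j<a rewrite filter-accept (suc j ≤?_) {a} {κ} j<a = z<s
<rowAt⇒<colAt {a ∷ b ∷ κ} d {suc i} {j} j<row rewrite filter-accept (suc j ≤?_) {a} {b ∷ κ} (≤-trans j<row (rowAt-≤-head d (suc (suc i))))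
  = s<s (<rowAt⇒<colAt (tail d) j<row)

<colAt⇒<rowAt : ∀ {κ} → Decreasing κ → ∀ {i j} → i < colAt κ (suc j) → j < rowAt κ (suc i)
<colAt⇒<rowAt {a ∷ κ} d {i} {j} i<col with suc j ≤? a
... | no j≮a rewrite filter-reject (suc j ≤?_) {a} {κ} j≮a
                   | filter-none (suc j ≤?_) (All.map (λ x≤a j<x → j≮a (≤-trans j<x x≤a)) (head-≥-rest d)) = contradiction i<col λ ()
<colAt⇒<rowAt {a ∷ κ} d {zero} {j} _ | yes j<a = j<a
<colAt⇒<rowAt {a ∷ []} d {suc i} {j} i<col | yes j<a rewrite filter-accept (suc j ≤?_) {a} {[]} j<a = contradiction (s<s⁻¹ i<col) λ ()
<colAt⇒<rowAt {a ∷ b ∷ κ} d {suc i} {j} i<col | yes j<a rewrite filter-accept (suc j ≤?_) {a} {b ∷ κ} j<a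
  = <colAt⇒<rowAt (tail d) (s<s⁻¹ i<col)

rowAt-antitone : ∀ {κ} → Decreasing κ → ∀ i → rowAt κ (suc (suc i)) ≤ rowAt κ (suc i)
rowAt-antitone {[]}        d           i       = z≤n
rowAt-antitone {a ∷ []}    d           i       = z≤n
rowAt-antitone {a ∷ b ∷ κ} (a≥b ∷ d)   zero    = a≥b
rowAt-antitone {a ∷ b ∷ κ} (a≥b ∷ d)   (suc i) = rowAt-antitone d i

rowAt-positive : ∀ {κ} → All (0 <_) κ → ∀ {i} → i < length κ → 0 < rowAt κ (suc i)
rowAt-positive {a ∷ κ}     (0<a ∷ _)   {zero}  _         = 0<a
rowAt-positive {a ∷ b ∷ κ} (_ ∷ pos)   {suc i} (s<s i<l) = rowAt-positive pos i<l

colAt-≤-length : ∀ κ j → colAt κ j ≤ length κ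
colAt-≤-length κ j = length-filter (j ≤?_) κ

colAt-1 : ∀ {κ} → All (0 <_) κ → colAt κ 1 ≡ length κ
colAt-1 pos = cong length (filter-all (1 ≤?_) pos)

colAt-antitone : ∀ {κ} → Decreasing κ → ∀ j → colAt κ (suc (suc j)) ≤ colAt κ (suc j)
colAt-antitone {κ} d j with colAt κ (suc (suc j)) in col≡
... | zero  = z≤n
... | suc i = <rowAt⇒<colAt d (<-trans (n<1+n j) (<colAt⇒<rowAt d (≤-reflexive (sym col≡))))

conj-applyUpTo : ∀ a κ → conj (a ∷ κ) ≡ applyUpTo (colAt (a ∷ κ) ∘ suc) a
conj-applyUpTo a κ = map-oneTo (colAt (a ∷ κ)) a

length-conj : ∀ a κ → length (conj (a ∷ κ)) ≡ a
length-conj a κ = trans (cong length (conj-applyUpTo a κ)) (length-applyUpTo _ a)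

rowAt-conj : ∀ {a κ k} → k < a → rowAt (conj (a ∷ κ)) (suc k) ≡ colAt (a ∷ κ) (suc k)
rowAt-conj {a} {κ} k<a = trans (cong (λ ρ → rowAt ρ _) (conj-applyUpTo a κ)) (rowAt-applyUpTo _ k<a)

colAt-conj : ∀ {a κ} → Decreasing (a ∷ κ) → ∀ i → colAt (conj (a ∷ κ)) (suc i) ≡ rowAt (a ∷ κ) (suc i)
colAt-conj {a} {κ} d i = begin
  colAt (conj (a ∷ κ)) (suc i)                                       ≡⟨ length-filter≡sum-𝟙 (suc i ≤?_) (conj (a ∷ κ)) ⟩
  sum (map (𝟙 ∘ does ∘ (suc i ≤?_)) (conj (a ∷ κ)))                  ≡⟨ cong sum (sym (map-∘ (oneTo a))) ⟩
  sum (map (𝟙 ∘ does ∘ (suc i ≤?_) ∘ colAt (a ∷ κ)) (oneTo a))       ≡⟨ cong sum (map-oneTo _ a) ⟩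
  sum (applyUpTo (𝟙 ∘ does ∘ (suc i ≤?_) ∘ colAt (a ∷ κ) ∘ suc) a)   ≡⟨ sum-applyUpTo _ a ⟩
  ∑[ j < a ] 𝟙 (does (suc i ≤? colAt (a ∷ κ) (suc j)))              ≡⟨ ∑<-cong a (λ j _ → cell⇔) ⟩
  ∑[ j < a ] (𝟙 (does (j <? rowAt (a ∷ κ) (suc i))) * 1)             ≡⟨ ∑<-restrict a (λ _ → 1) (rowAt-≤-head d (suc i)) ⟩
  ∑[ _ < rowAt (a ∷ κ) (suc i) ] 1                                   ≡⟨ ∑<-const-1 _ ⟩
  rowAt (a ∷ κ) (suc i)                                              ∎
  where
  open ≡-Reasoning
  cell⇔ : ∀ {j} → 𝟙 (does (suc i ≤? colAt (a ∷ κ) (suc j))) ≡ 𝟙 (does (j <? rowAt (a ∷ κ) (suc i))) * 1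
  cell⇔ {j} = trans (cong 𝟙 (does-⇔ (mk⇔ (<colAt⇒<rowAt d) (<rowAt⇒<colAt d)) (suc i ≤? _) (j <? _))) (sym (*-identityʳ _))

hook-conj : ∀ {a κ} → Decreasing (a ∷ κ) → ∀ {i k} → k < a → hook (conj (a ∷ κ)) (suc k) (suc i) ≡ hook (a ∷ κ) (suc i) (suc k)
hook-conj {a} {κ} d {i} {k} k<a rewrite rowAt-conj {a} {κ} k<a | colAt-conj d i =
  cong (_+ 1) (+-comm (colAt (a ∷ κ) (suc k) ∸ suc i) (rowAt (a ∷ κ) (suc i) ∸ suc k))

hook+i+j : ∀ ρ {i j} → j ≤ rowAt ρ i → i ≤ colAt ρ j → hook ρ i j + (i + j) ≡ rowAt ρ i + colAt ρ j + 1
hook+i+j ρ {i} {j} j≤r i≤c = begin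
  (rowAt ρ i ∸ j) + (colAt ρ j ∸ i) + 1 + (i + j)   ≡⟨ rearrange (rowAt ρ i ∸ j) (colAt ρ j ∸ i) i j ⟩
  (rowAt ρ i ∸ j + j) + (colAt ρ j ∸ i + i) + 1     ≡⟨ cong₂ (λ r c → r + c + 1) (m∸n+n≡m j≤r) (m∸n+n≡m i≤c) ⟩
  rowAt ρ i + colAt ρ j + 1                         ∎
  where
  open ≡-Reasoning
  open +-*-Solver
  rearrange : ∀ u v i j → u + v + 1 + (i + j) ≡ (u + j) + (v + i) + 1
  rearrange = solve 4 (λ u v i j → u :+ v :+ con 1 :+ (i :+ j) := (u :+ j) :+ (v :+ i) :+ con 1) refl

0<hook : ∀ ρ i j → 0 < hook ρ i j
0<hook ρ i j = m≤n+m 1 _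

firstColHooks-applyUpTo : ∀ ρ → firstColHooks ρ ≡ applyUpTo (λ k → hook ρ (suc k) 1) (length ρ)
firstColHooks-applyUpTo ρ = map-oneTo (λ i → hook ρ i 1) (length ρ)

skl≡∑ : ∀ n p ρ → skl n p ρ ≡ ∑[ k < length ρ ] (𝟙 (not ((hook ρ (suc k) 1 + n) ∈ᵇ firstColHooks ρ)) * smallHooksInRow p ρ (suc k))
skl≡∑ n p ρ = begin
  skl n p ρ                                                                     ≡⟨ sum-map-filter (isNRow? n ρ) _ (oneTo (length ρ)) ⟩
  sum (map (λ i → 𝟙 (does (isNRow? n ρ i)) * smallHooksInRow p ρ i) (oneTo (length ρ))) ≡⟨ cong sum (map-oneTo _ (length ρ)) ⟩
  sum (applyUpTo (λ k → 𝟙 (does (isNRow? n ρ (suc k))) * smallHooksInRow p ρ (suc k)) (length ρ)) ≡⟨ sum-applyUpTo _ (length ρ) ⟩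
  ∑[ k < length ρ ] (𝟙 (not ((hook ρ (suc k) 1 + n) ∈ᵇ firstColHooks ρ)) * smallHooksInRow p ρ (suc k)) ∎
  where open ≡-Reasoning

smallHooksInRow≡∑ : ∀ p ρ i {M} → rowAt ρ i ≤ M →
                    smallHooksInRow p ρ i ≡ ∑[ j < M ] (𝟙 (does (j <? rowAt ρ i)) * 𝟙 (does (hook ρ i (suc j) <? p)))
smallHooksInRow≡∑ p ρ i {M} row≤M = begin
  smallHooksInRow p ρ i                                                   ≡⟨ length-filter≡sum-𝟙 (λ j → hook ρ i j <? p) (oneTo (rowAt ρ i)) ⟩
  sum (map (λ j → 𝟙 (does (hook ρ i j <? p))) (oneTo (rowAt ρ i)))        ≡⟨ cong sum (map-oneTo _ (rowAt ρ i)) ⟩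
  sum (applyUpTo (λ j → 𝟙 (does (hook ρ i (suc j) <? p))) (rowAt ρ i))    ≡⟨ sum-applyUpTo _ (rowAt ρ i) ⟩
  ∑[ j < rowAt ρ i ] 𝟙 (does (hook ρ i (suc j) <? p))                      ≡⟨ ∑<-restrict M _ row≤M ⟨
  ∑[ j < M ] (𝟙 (does (j <? rowAt ρ i)) * 𝟙 (does (hook ρ i (suc j) <? p))) ∎
  where open ≡-Reasoning

-- H and F play the first-column and first-row hook sets of a partition whose corner hook
-- length is N, and W the window (N, N + p) through which h + f = hook + N detects hooks below p.
module ComplementaryBetaSets
  (N n : ℕ) (H F W : ℕ → Bool)
  (H-bounded : ∀ x → H x ≡ true → x ≤ N)
  (F-bounded : ∀ y → F y ≡ true → y ≤ N)
  (F-complement : ∀ y → y ≤ N → F y ≡ not (H (N ∸ y)))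
  (H-closed : ∀ x → H x ≡ true → n ≤ x → H (x ∸ n) ≡ true)
  (W-above : ∀ s → W s ≡ true → N < s)
  where

  F-closed : ∀ y → F y ≡ true → n ≤ y → F (y ∸ n) ≡ true
  F-closed y Fy n≤y = trans (F-complement (y ∸ n) (≤-trans (m∸n≤m y n) y≤N)) (cong not H[N∸[y∸n]]≡false)
    where
    y≤N = F-bounded y Fy
    H[N∸y]≡false : H (N ∸ y) ≡ false
    H[N∸y]≡false = not-injective (trans (sym (F-complement y y≤N)) Fy)
    n≤N∸[y∸n] : n ≤ N ∸ (y ∸ n)
    n≤N∸[y∸n] = m+n≤o⇒m≤o∸n n (≤-trans (≤-reflexive (trans (+-comm n (y ∸ n)) (m∸n+n≡m n≤y))) y≤N)
    N∸[y∸n]∸n≡N∸y : N ∸ (y ∸ n) ∸ n ≡ N ∸ y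
    N∸[y∸n]∸n≡N∸y = trans (∸-+-assoc N (y ∸ n) n) (cong (N ∸_) (m∸n+n≡m n≤y))
    H[N∸[y∸n]]≡false : H (N ∸ (y ∸ n)) ≡ false
    H[N∸[y∸n]]≡false = ¬-not λ H[N∸[y∸n]] →
      contradiction (trans (sym (H-closed _ H[N∸[y∸n]] n≤N∸[y∸n])) (trans (cong H N∸[y∸n]∸n≡N∸y) H[N∸y]≡false)) λ ()

  pair : ℕ → ℕ → Bool
  pair x y = H x ∧ F y ∧ W (x + y)

  pair⁺ : ∀ {x y} → H x ≡ true → F y ≡ true → W (x + y) ≡ true → pair x y ≡ true
  pair⁺ Hx Fy Wx+y = ∧-intro Hx (∧-intro Fy Wx+y)

  pair⇒H : ∀ {x y} → pair x y ≡ true → H x ≡ true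
  pair⇒H {x} {y} = ∧-conicalˡ (H x) (F y ∧ W (x + y))

  pair⇒F : ∀ {x y} → pair x y ≡ true → F y ≡ true
  pair⇒F {x} {y} p = ∧-conicalˡ (F y) (W (x + y)) (∧-conicalʳ (H x) _ p)

  pair⇒W : ∀ {x y} → pair x y ≡ true → W (x + y) ≡ true
  pair⇒W {x} {y} p = ∧-conicalʳ (F y) (W (x + y)) (∧-conicalʳ (H x) _ p)

  -- As x + y > N while H, F ⊆ [0, N], moving n from one coordinate to the other never
  -- leaves [0, N], and closure under − n keeps the pair inside H × F.
  raise-H : ∀ {x y} → pair x y ≡ true → H (x + n) ≡ true → n ≤ y × pair (x + n) (y ∸ n) ≡ true
  raise-H {x} {y} p Hx+n = n≤y , pair⁺ Hx+n (F-closed y (pair⇒F p) n≤y) (subst (λ s → W s ≡ true) (sym x+n+[y∸n]≡x+y) (pair⇒W p))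
    where
    n≤y : n ≤ y
    n≤y = +-cancelˡ-≤ x n y (<⇒≤ (≤-<-trans (H-bounded (x + n) Hx+n) (W-above (x + y) (pair⇒W p))))
    x+n+[y∸n]≡x+y : x + n + (y ∸ n) ≡ x + y
    x+n+[y∸n]≡x+y = trans (+-assoc x n (y ∸ n)) (cong (x +_) (m+[n∸m]≡n n≤y))

  raise-F : ∀ {x y} → pair x y ≡ true → F (y + n) ≡ true → n ≤ x × pair (x ∸ n) (y + n) ≡ true
  raise-F {x} {y} p Fy+n = n≤x , pair⁺ (H-closed x (pair⇒H p) n≤x) Fy+n (subst (λ s → W s ≡ true) (sym x∸n+[y+n]≡x+y) (pair⇒W p))
    where
    n≤x : n ≤ x
    n≤x = +-cancelʳ-≤ y n x (<⇒≤ (≤-<-trans (≤-reflexive (+-comm n y)) (≤-<-trans (F-bounded (y + n) Fy+n) (W-above (x + y) (pair⇒W p)))))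
    x∸n+[y+n]≡x+y : x ∸ n + (y + n) ≡ x + y
    x∸n+[y+n]≡x+y = trans (cong (x ∸ n +_) (+-comm y n)) (trans (sym (+-assoc (x ∸ n) n y)) (cong (_+ y) (m∸n+n≡m n≤x)))

  linked : ℕ → ℕ → Bool
  linked x y = pair x y ∧ does (n ≤? y) ∧ pair (x + n) (y ∸ n)

  linked⁺ : ∀ {x y} → pair x y ≡ true → n ≤ y × pair (x + n) (y ∸ n) ≡ true → linked x y ≡ true
  linked⁺ {y = y} p (n≤y , p′) = ∧-intro p (∧-intro (dec-true (n ≤? y) n≤y) p′)

  pair-∧-H-raised : ∀ x y → pair x y ∧ H (x + n) ≡ linked x y
  pair-∧-H-raised x y = ⇔→≡ {z = true} (mk⇔ to from)
    where
    to : pair x y ∧ H (x + n) ≡ true → linked x y ≡ true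
    to q = linked⁺ p (raise-H p (∧-conicalʳ (pair x y) _ q))
      where p = ∧-conicalˡ (pair x y) _ q
    from : linked x y ≡ true → pair x y ∧ H (x + n) ≡ true
    from q = ∧-intro (∧-conicalˡ (pair x y) _ q) (pair⇒H (∧-conicalʳ (does (n ≤? y)) _ (∧-conicalʳ (pair x y) _ q)))

  pair-∧-F-raised : ∀ x y → pair x y ∧ F (y + n) ≡ does (n ≤? x) ∧ linked (x ∸ n) (y + n)
  pair-∧-F-raised x y = ⇔→≡ {z = true} (mk⇔ to from)
    where
    to : pair x y ∧ F (y + n) ≡ true → does (n ≤? x) ∧ linked (x ∸ n) (y + n) ≡ true
    to q with raise-F (∧-conicalˡ (pair x y) _ q) (∧-conicalʳ (pair x y) _ q)
    ... | n≤x , p′ = ∧-intro (dec-true (n ≤? x) n≤x) (linked⁺ p′ (m≤n+m n y , p))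
      where
      p : pair (x ∸ n + n) (y + n ∸ n) ≡ true
      p rewrite m∸n+n≡m n≤x | m+n∸n≡m y n = ∧-conicalˡ (pair x y) _ q
    from : does (n ≤? x) ∧ linked (x ∸ n) (y + n) ≡ true → pair x y ∧ F (y + n) ≡ true
    from q = ∧-intro p (pair⇒F (∧-conicalˡ (pair (x ∸ n) (y + n)) _ q′))
      where
      q′ : linked (x ∸ n) (y + n) ≡ true
      q′ = ∧-conicalʳ (does (n ≤? x)) _ q
      p : pair x y ≡ true
      p = subst₂ (λ u v → pair u v ≡ true) (m∸n+n≡m (does⇒ (n ≤? x) (∧-conicalˡ (does (n ≤? x)) _ q))) (m+n∸n≡m y n)
                 (∧-conicalʳ (does (n ≤? y + n)) _ (∧-conicalʳ (pair (x ∸ n) (y + n)) _ q′))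

  K : ℕ
  K = n + suc N

  count : (ℕ → ℕ → Bool) → ℕ
  count q = ∑[ x < K ] ∑[ y < K ] 𝟙 (pair x y ∧ q x y)

  linked-count : ℕ
  linked-count = ∑[ x < K ] ∑[ y < K ] 𝟙 (linked x y)

  count-not+count : ∀ q → count (λ x y → not (q x y)) + count q ≡ ∑[ x < K ] ∑[ y < K ] 𝟙 (pair x y)
  count-not+count q = trans (sym (∑<-distrib-+ K _ _)) (∑<-cong K λ x _ →
    trans (sym (∑<-distrib-+ K _ _)) (∑<-cong K λ y _ → 𝟙-∧-not+𝟙-∧ (pair x y) (q x y)))

  count-H-raised : count (λ x y → H (x + n)) ≡ linked-count
  count-H-raised = ∑<-cong K λ x _ → ∑<-cong K λ y _ → cong 𝟙 (pair-∧-H-raised x y)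

  pair-beyondˣ : ∀ {x y} → N < x → pair x y ≡ false
  pair-beyondˣ {x} N<x = ¬-not λ p → <⇒≱ N<x (H-bounded x (pair⇒H p))

  pair-beyondʸ : ∀ {x y} → N < y → pair x y ≡ false
  pair-beyondʸ {y = y} N<y = ¬-not λ p → <⇒≱ N<y (F-bounded y (pair⇒F p))

  count-F-raised : count (λ x y → F (y + n)) ≡ linked-count
  count-F-raised = begin
    count (λ x y → F (y + n))
      ≡⟨ (∑<-cong K λ x _ → ∑<-cong K λ y _ → trans (cong 𝟙 (pair-∧-F-raised x y)) (𝟙-∧ (does (n ≤? x)) _)) ⟩
    ∑[ x < K ] ∑[ y < K ] (𝟙 (does (n ≤? x)) * 𝟙 (linked (x ∸ n) (y + n)))
      ≡⟨ (∑<-cong K λ x _ → sym (*-distribˡ-∑< K (𝟙 (does (n ≤? x))) _)) ⟩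
    ∑[ x < K ] (𝟙 (does (n ≤? x)) * ∑[ y < K ] 𝟙 (linked (x ∸ n) (y + n)))
      ≡⟨ (∑<-cong K λ x _ → cong (𝟙 (does (n ≤? x)) *_) (lower-y (x ∸ n))) ⟩
    ∑[ x < K ] (𝟙 (does (n ≤? x)) * row (x ∸ n))
      ≡⟨ ∑<-shift-up n K row row-beyond ⟩
    linked-count ∎
    where
    open ≡-Reasoning
    row : ℕ → ℕ
    row x = ∑[ y < K ] 𝟙 (linked x y)
    lower-y : ∀ x → ∑[ y < K ] 𝟙 (linked x (y + n)) ≡ row x
    lower-y x = trans (∑<-cong K λ y _ → cong (𝟙 ∘ linked x) (+-comm y n)) (∑<-shift n K (𝟙 ∘ linked x) below above)
      where
      below : ∀ y → y < n → 𝟙 (linked x y) ≡ 0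
      below y y<n = cong 𝟙 (trans (cong (λ b → pair x y ∧ b ∧ pair (x + n) (y ∸ n)) (dec-false (n ≤? y) (<⇒≱ y<n))) (∧-zeroʳ (pair x y)))
      above : ∀ y → K ≤ y → 𝟙 (linked x y) ≡ 0
      above y K≤y = cong (λ b → 𝟙 (b ∧ does (n ≤? y) ∧ pair (x + n) (y ∸ n))) (pair-beyondʸ (≤-trans (m≤n+m (suc N) n) K≤y))
    row-beyond : ∀ x → K ∸ n ≤ x → row x ≡ 0
    row-beyond x K∸n≤x = ∑<-vanishing K λ y _ →
      cong (λ b → 𝟙 (b ∧ does (n ≤? y) ∧ pair (x + n) (y ∸ n))) (pair-beyondˣ (subst (_≤ x) (m+n∸m≡n n (suc N)) K∸n≤x))

  count-not-H-raised≡count-not-F-raised : count (λ x y → not (H (x + n))) ≡ count (λ x y → not (F (y + n)))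
  count-not-H-raised≡count-not-F-raised = +-cancelʳ-≡ linked-count _ _ (begin
    count (λ x y → not (H (x + n))) + linked-count                   ≡⟨ cong (count (λ x y → not (H (x + n))) +_) count-H-raised ⟨
    count (λ x y → not (H (x + n))) + count (λ x y → H (x + n))      ≡⟨ count-not+count (λ x y → H (x + n)) ⟩
    ∑[ x < K ] ∑[ y < K ] 𝟙 (pair x y)                               ≡⟨ count-not+count (λ x y → F (y + n)) ⟨
    count (λ x y → not (F (y + n))) + count (λ x y → F (y + n))      ≡⟨ cong (count (λ x y → not (F (y + n))) +_) count-F-raised ⟩
    count (λ x y → not (F (y + n))) + linked-count                   ∎)
    where open ≡-Reasoning

  H-side F-side : ℕ
  H-side = ∑[ x < K ] (𝟙 (H x ∧ not (H (x + n))) * ∑[ y < K ] 𝟙 (F y ∧ W (x + y)))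
  F-side = ∑[ y < K ] (𝟙 (F y ∧ not (F (y + n))) * ∑[ x < K ] 𝟙 (H x ∧ W (x + y)))

  H-side≡F-side : H-side ≡ F-side
  H-side≡F-side = begin
    H-side                                ≡⟨ (∑<-cong K λ x _ → trans (*-distribˡ-∑< K (𝟙 (H x ∧ not (H (x + n)))) _) (∑<-cong K λ y _ →
                                               𝟙[a∧b]*𝟙[c∧d]≡𝟙[[a∧c∧d]∧b] (H x) (not (H (x + n))) (F y) (W (x + y)))) ⟩
    count (λ x y → not (H (x + n)))       ≡⟨ count-not-H-raised≡count-not-F-raised ⟩
    count (λ x y → not (F (y + n)))       ≡⟨ ∑<-comm K K _ ⟩
    ∑[ y < K ] ∑[ x < K ] 𝟙 (pair x y ∧ not (F (y + n)))
                                          ≡⟨ (∑<-cong K λ y _ → trans (*-distribˡ-∑< K (𝟙 (F y ∧ not (F (y + n)))) _) (∑<-cong K λ x _ →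
                                               𝟙[a∧b]*𝟙[c∧d]≡𝟙[[c∧a∧d]∧b] (F y) (not (F (y + n))) (H x) (W (x + y)))) ⟨
    F-side                                ∎
    where open ≡-Reasoning

index-decreasing : ∀ {g′ g r′ r M k} → g′ + suc (suc k) ≡ r′ + M → g + suc k ≡ r + M → r′ ≤ r → g′ < g
index-decreasing {g′} {g} {r′} {r} {M} {k} e′ e r′≤r = +-cancelʳ-≤ (suc k) (suc g′) g (begin
  suc g′ + suc k     ≡⟨ +-suc g′ (suc k) ⟨
  g′ + suc (suc k)   ≡⟨ e′ ⟩
  r′ + M             ≤⟨ +-monoˡ-≤ M r′≤r ⟩
  r + M              ≡⟨ e ⟨
  g + suc k          ∎)
  where open ≤-Reasoning

index-bounded : ∀ {g r M k B} → g + suc k ≡ r + M → r + M ≤ B → g < B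
index-bounded {g} {k = k} e r+M≤B = <-≤-trans (m<m+n g z<s) (≤-trans (≤-reflexive e) r+M≤B)

m+[o∸[m∸n]]≡o+n : ∀ {m n o} → n ≤ m → m ≤ o → m + (o ∸ (m ∸ n)) ≡ o + n
m+[o∸[m∸n]]≡o+n {m} {n} {o} n≤m m≤o = begin
  m + (o ∸ (m ∸ n))              ≡⟨ cong (_+ (o ∸ (m ∸ n))) (m∸n+n≡m n≤m) ⟨
  m ∸ n + n + (o ∸ (m ∸ n))      ≡⟨ xy∙z≈xz∙y (m ∸ n) n (o ∸ (m ∸ n)) ⟩
  m ∸ n + (o ∸ (m ∸ n)) + n      ≡⟨ cong (_+ n) (m+[n∸m]≡n (≤-trans (m∸n≤m m n) m≤o)) ⟩
  o + n                          ∎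
  where open ≡-Reasoning

module HookSets (a : ℕ) (κ₀ : List ℕ) (κ-partition : IsPartition (a ∷ κ₀)) where

  κ : List ℕ
  κ = a ∷ κ₀

  decreasing : Decreasing κ
  decreasing = proj₁ κ-partition

  L N : ℕ
  L = length κ
  N = length κ₀ + a

  h f : ℕ → ℕ
  h k = hook κ (suc k) 1
  f k = hook κ 1 (suc k)

  h+index : ∀ {k} → k < L → h k + suc k ≡ rowAt κ (suc k) + L
  h+index {k} k<L = +-cancelʳ-≡ 1 _ _ (begin
    h k + suc k + 1           ≡⟨ +-assoc (h k) (suc k) 1 ⟩
    h k + (suc k + 1)         ≡⟨ hook+i+j κ (rowAt-positive (proj₂ κ-partition) k<L) (subst (suc k ≤_) (sym L≡colAt1) k<L) ⟩
    rowAt κ (suc k) + colAt κ 1 + 1 ≡⟨ cong (λ c → rowAt κ (suc k) + c + 1) L≡colAt1 ⟩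
    rowAt κ (suc k) + L + 1   ∎)
    where
    open ≡-Reasoning
    L≡colAt1 : colAt κ 1 ≡ L
    L≡colAt1 = colAt-1 (proj₂ κ-partition)

  f+index : ∀ {k} → k < a → f k + suc k ≡ colAt κ (suc k) + a
  f+index {k} k<a = suc-injective (begin
    suc (f k + suc k)         ≡⟨ +-suc (f k) (suc k) ⟨
    f k + (1 + suc k)         ≡⟨ hook+i+j κ {1} {suc k} k<a (<rowAt⇒<colAt decreasing {0} k<a) ⟩
    a + colAt κ (suc k) + 1   ≡⟨ +-comm (a + colAt κ (suc k)) 1 ⟩
    suc (a + colAt κ (suc k)) ≡⟨ cong suc (+-comm a (colAt κ (suc k))) ⟩
    suc (colAt κ (suc k) + a) ∎)
    where open ≡-Reasoning

  h+f+indices : ∀ {k k′} → k < L → k′ < a → h k + f k′ + (suc k + suc k′) ≡ rowAt κ (suc k) + colAt κ (suc k′) + suc N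
  h+f+indices {k} {k′} k<L k′<a = begin
    h k + f k′ + (suc k + suc k′)                       ≡⟨ interchange (h k) (f k′) (suc k) (suc k′) ⟩
    (h k + suc k) + (f k′ + suc k′)                     ≡⟨ cong₂ _+_ (h+index k<L) (f+index k′<a) ⟩
    (rowAt κ (suc k) + L) + (colAt κ (suc k′) + a)      ≡⟨ interchange (rowAt κ (suc k)) L (colAt κ (suc k′)) a ⟩
    rowAt κ (suc k) + colAt κ (suc k′) + suc N          ∎
    where open ≡-Reasoning

  hook+N≡h+f : ∀ {k k′} → k < L → k′ < a → k′ < rowAt κ (suc k) → hook κ (suc k) (suc k′) + N ≡ h k + f k′
  hook+N≡h+f {k} {k′} k<L k′<a k′<row = +-cancelʳ-≡ (suc k + suc k′) _ _ (begin
    hook κ (suc k) (suc k′) + N + (suc k + suc k′)      ≡⟨ xy∙z≈xz∙y (hook κ (suc k) (suc k′)) N (suc k + suc k′) ⟩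
    hook κ (suc k) (suc k′) + (suc k + suc k′) + N      ≡⟨ cong (_+ N) (hook+i+j κ {suc k} {suc k′} k′<row (<rowAt⇒<colAt decreasing k′<row)) ⟩
    rowAt κ (suc k) + colAt κ (suc k′) + 1 + N          ≡⟨ +-assoc (rowAt κ (suc k) + colAt κ (suc k′)) 1 N ⟩
    rowAt κ (suc k) + colAt κ (suc k′) + suc N          ≡⟨ h+f+indices k<L k′<a ⟨
    h k + f k′ + (suc k + suc k′)                       ∎)
    where open ≡-Reasoning

  h+f<N : ∀ {k k′} → k < L → k′ < a → ¬ k′ < rowAt κ (suc k) → h k + f k′ < N
  h+f<N {k} {k′} k<L k′<a k′≮row = s≤s⁻¹ (+-cancelʳ-≤ (k + k′) (suc (suc (h k + f k′))) (suc N) (begin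
    suc (suc (h k + f k′)) + (k + k′)                   ≡⟨ shift-suc (h k + f k′) k k′ ⟩
    h k + f k′ + (suc k + suc k′)                       ≡⟨ h+f+indices k<L k′<a ⟩
    rowAt κ (suc k) + colAt κ (suc k′) + suc N          ≤⟨ +-monoˡ-≤ (suc N) (+-mono-≤ (≮⇒≥ k′≮row) (≮⇒≥ k≮col)) ⟩
    k′ + k + suc N                                      ≡⟨ +-comm (k′ + k) (suc N) ⟩
    suc N + (k′ + k)                                    ≡⟨ cong (suc N +_) (+-comm k′ k) ⟩
    suc N + (k + k′)                                    ∎))
    where
    open ≤-Reasoning
    open +-*-Solver
    k≮col : ¬ k < colAt κ (suc k′)
    k≮col k<col = k′≮row (<colAt⇒<rowAt decreasing k<col)
    shift-suc : ∀ s k k′ → suc (suc s) + (k + k′) ≡ s + (suc k + suc k′)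
    shift-suc = solve 3 (λ s k k′ → con 2 :+ s :+ (k :+ k′) := s :+ (con 1 :+ k :+ (con 1 :+ k′))) refl

  h+f≢N : ∀ {k k′} → k < L → k′ < a → h k + f k′ ≢ N
  h+f≢N {k} {k′} k<L k′<a h+f≡N with k′ <? rowAt κ (suc k)
  ... | yes k′<row = <-irrefl (sym h+f≡N) (subst (N <_) (hook+N≡h+f k<L k′<a k′<row) (m<n+m N (0<hook κ (suc k) (suc k′))))
  ... | no  k′≮row = <-irrefl h+f≡N (h+f<N k<L k′<a k′≮row)

  h<1+N : ∀ {k} → k < L → h k < suc N
  h<1+N {k} k<L = index-bounded {r = rowAt κ (suc k)} {M = L} (h+index k<L) (≤-trans (+-monoˡ-≤ L (rowAt-≤-head decreasing (suc k))) (≤-reflexive (+-comm a L)))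

  f<1+N : ∀ {k} → k < a → f k < suc N
  f<1+N {k} k<a = index-bounded {r = colAt κ (suc k)} {M = a} (f+index k<a) (+-monoˡ-≤ a (colAt-≤-length κ (suc k)))

  h-decreasing : ∀ k → suc k < L → h (suc k) < h k
  h-decreasing k 1+k<L = index-decreasing (h+index 1+k<L) (h+index (<-trans (n<1+n k) 1+k<L)) (rowAt-antitone decreasing k)

  f-decreasing : ∀ k → suc k < a → f (suc k) < f k
  f-decreasing k 1+k<a = index-decreasing (f+index 1+k<a) (f+index (<-trans (n<1+n k) 1+k<a)) (colAt-antitone decreasing k)

  H F : ℕ → Bool
  H x = x ∈ᵇ firstColHooks κ
  F y = y ∈ᵇ firstColHooks (conj κ)

  firstColHooks≡h : firstColHooks κ ≡ applyUpTo h L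
  firstColHooks≡h = firstColHooks-applyUpTo κ

  firstColHooks-conj≡f : firstColHooks (conj κ) ≡ applyUpTo f a
  firstColHooks-conj≡f = begin
    firstColHooks (conj κ)                                          ≡⟨ firstColHooks-applyUpTo (conj κ) ⟩
    applyUpTo (λ k → hook (conj κ) (suc k) 1) (length (conj κ))     ≡⟨ cong (applyUpTo _) (length-conj a κ₀) ⟩
    applyUpTo (λ k → hook (conj κ) (suc k) 1) a                     ≡⟨ applyUpTo-cong a (λ k k<a → hook-conj decreasing {0} k<a) ⟩
    applyUpTo f a                                                   ∎
    where open ≡-Reasoning

  ∑-over-H : ∀ K → suc N ≤ K → ∀ (φ : ℕ → ℕ) → ∑[ x < K ] (𝟙 (H x) * φ x) ≡ ∑[ k < L ] φ (h k)
  ∑-over-H K 1+N≤K φ = trans (cong (λ xs → ∑[ x < K ] (𝟙 (x ∈ᵇ xs) * φ x)) firstColHooks≡h) $ ∑<-∈ᵇ-applyUpTo K φ h L h-decreasing (λ k k<L → <-≤-trans (h<1+N k<L) 1+N≤K)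

  ∑-over-F : ∀ K → suc N ≤ K → ∀ (φ : ℕ → ℕ) → ∑[ y < K ] (𝟙 (F y) * φ y) ≡ ∑[ k < a ] φ (f k)
  ∑-over-F K 1+N≤K φ = trans (cong (λ xs → ∑[ y < K ] (𝟙 (y ∈ᵇ xs) * φ y)) firstColHooks-conj≡f) $ ∑<-∈ᵇ-applyUpTo K φ f a f-decreasing (λ k k<a → <-≤-trans (f<1+N k<a) 1+N≤K)

  H⁻ : ∀ {x} → H x ≡ true → ∃ λ k → k < L × h k ≡ x
  H⁻ {x} Hx = ∈ᵇ-applyUpTo⁻ h L (subst (λ xs → x ∈ᵇ xs ≡ true) firstColHooks≡h Hx)

  F⁻ : ∀ {y} → F y ≡ true → ∃ λ k → k < a × f k ≡ y
  F⁻ {y} Fy = ∈ᵇ-applyUpTo⁻ f a (subst (λ xs → y ∈ᵇ xs ≡ true) firstColHooks-conj≡f Fy)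

  H-bounded : ∀ x → H x ≡ true → x ≤ N
  H-bounded x Hx with H⁻ Hx
  ... | k , k<L , refl = s≤s⁻¹ (h<1+N k<L)

  F-bounded : ∀ y → F y ≡ true → y ≤ N
  F-bounded y Fy with F⁻ Fy
  ... | k , k<a , refl = s≤s⁻¹ (f<1+N k<a)

  |H| : ∑[ x < suc N ] 𝟙 (H x) ≡ L
  |H| = trans (∑<-cong (suc N) λ x _ → sym (*-identityʳ (𝟙 (H x)))) (trans (∑-over-H (suc N) ≤-refl (λ _ → 1)) (∑<-const-1 L))

  |F| : ∑[ y < suc N ] 𝟙 (F y) ≡ a
  |F| = trans (∑<-cong (suc N) λ y _ → sym (*-identityʳ (𝟙 (F y)))) (trans (∑-over-F (suc N) ≤-refl (λ _ → 1)) (∑<-const-1 a))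

  F-complement : ∀ y → y ≤ N → F y ≡ not (H (N ∸ y))
  F-complement = complement-by-counting N H F disjoint (cong₂ _+_ |H| |F|)
    where
    disjoint : ∀ x → x ≤ N → H x ≡ true → F (N ∸ x) ≡ true → ⊥
    disjoint x x≤N Hx FN∸x with H⁻ Hx | F⁻ FN∸x
    ... | k , k<L , hk≡x | k′ , k′<a , fk′≡N∸x = h+f≢N k<L k′<a (trans (cong₂ _+_ hk≡x fk′≡N∸x) (m+[n∸m]≡n x≤N))

  module SkewLengths (n p : ℕ) (no-hook-n : ∀ i j → InDiagram κ i j → hook κ i j ≢ n) where

    h+f≢N+n : ∀ {k k′} → k < L → k′ < a → h k + f k′ ≢ N + n
    h+f≢N+n {k} {k′} k<L k′<a h+f≡N+n with k′ <? rowAt κ (suc k)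
    ... | yes k′<row = no-hook-n (suc k) (suc k′) (s≤s z≤n , k<L , s≤s z≤n , k′<row)
                         (+-cancelʳ-≡ N _ n (trans (hook+N≡h+f k<L k′<a k′<row) (trans h+f≡N+n (+-comm N n))))
    ... | no  k′≮row = <⇒≱ (h+f<N k<L k′<a k′≮row) (subst (N ≤_) (sym h+f≡N+n) (m≤m+n N n))

    -- If x − n were missing from H, the first-row hook N − (x − n) would complete x to a sum N + n.
    H-closed : ∀ x → H x ≡ true → n ≤ x → H (x ∸ n) ≡ true
    H-closed x Hx n≤x = ¬-not λ H[x∸n]≡false → missing (F[N∸[x∸n]] H[x∸n]≡false)
      where
      x≤N = H-bounded x Hx
      F[N∸[x∸n]] : H (x ∸ n) ≡ false → F (N ∸ (x ∸ n)) ≡ true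
      F[N∸[x∸n]] H[x∸n]≡false = trans (F-complement _ (m∸n≤m N (x ∸ n)))
        (trans (cong (not ∘ H) (m∸[m∸n]≡n (≤-trans (m∸n≤m x n) x≤N))) (cong not H[x∸n]≡false))
      missing : F (N ∸ (x ∸ n)) ≡ true → ⊥
      missing F[N∸[x∸n]]≡true with H⁻ Hx | F⁻ F[N∸[x∸n]]≡true
      ... | k , k<L , hk≡x | k′ , k′<a , fk′≡ = h+f≢N+n k<L k′<a (begin
        h k + f k′              ≡⟨ cong₂ _+_ hk≡x fk′≡ ⟩
        x + (N ∸ (x ∸ n))       ≡⟨ m+[o∸[m∸n]]≡o+n n≤x x≤N ⟩
        N + n                   ∎)
        where open ≡-Reasoning

    W : ℕ → Bool
    W s = does (N <? s) ∧ does (s <? N + p)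

    W-above : ∀ s → W s ≡ true → N < s
    W-above s Ws = does⇒ (N <? s) (∧-conicalˡ (does (N <? s)) _ Ws)

    W[hook+N] : ∀ {hk} → 0 < hk → W (hk + N) ≡ does (hk <? p)
    W[hook+N] {hk} 0<hk rewrite dec-true (N <? hk + N) (m<n+m N 0<hk) =
      does-⇔ (mk⇔ (λ lt → +-cancelʳ-< N hk p (subst (hk + N <_) (+-comm N p) lt))
                  (λ lt → subst (hk + N <_) (+-comm p N) (+-monoˡ-< N lt)))
             (hk + N <? N + p) (hk <? p)

    cell-window : ∀ {k k′} → k < L → k′ < a →
                  𝟙 (does (k′ <? rowAt κ (suc k))) * 𝟙 (does (hook κ (suc k) (suc k′) <? p)) ≡ 𝟙 (W (h k + f k′))
    cell-window {k} {k′} k<L k′<a with k′ <? rowAt κ (suc k)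
    ... | yes k′<row rewrite dec-true (k′ <? rowAt κ (suc k)) k′<row = trans (+-identityʳ _) (cong 𝟙 (sym (trans (cong W (sym (hook+N≡h+f k<L k′<a k′<row))) (W[hook+N] (0<hook κ (suc k) (suc k′))))))
    ... | no  k′≮row rewrite dec-false (k′ <? rowAt κ (suc k)) k′≮row = cong 𝟙 (sym (cong (_∧ does (h k + f k′ <? N + p)) (dec-false (N <? h k + f k′) (<⇒≯ (h+f<N k<L k′<a k′≮row)))))

    row-count : ∀ {k} → k < L → smallHooksInRow p κ (suc k) ≡ ∑[ k′ < a ] 𝟙 (W (h k + f k′))
    row-count {k} k<L = trans (smallHooksInRow≡∑ p κ (suc k) (rowAt-≤-head decreasing (suc k)))
                              (∑<-cong a λ k′ k′<a → cell-window k<L k′<a)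

    column-count : ∀ {k′} → k′ < a → smallHooksInRow p (conj κ) (suc k′) ≡ ∑[ k < L ] 𝟙 (W (h k + f k′))
    column-count {k′} k′<a = begin
      smallHooksInRow p (conj κ) (suc k′)
        ≡⟨ smallHooksInRow≡∑ p (conj κ) (suc k′) (subst (_≤ L) (sym (rowAt-conj {a} {κ₀} k′<a)) (colAt-≤-length κ (suc k′))) ⟩
      ∑[ k < L ] (𝟙 (does (k <? rowAt (conj κ) (suc k′))) * 𝟙 (does (hook (conj κ) (suc k′) (suc k) <? p)))
        ≡⟨ (∑<-cong L λ k _ → cong₂ (λ c t → 𝟙 (does (k <? c)) * 𝟙 (does (t <? p))) (rowAt-conj {a} {κ₀} k′<a) (hook-conj decreasing {k} k′<a)) ⟩
      ∑[ k < L ] (𝟙 (does (k <? colAt κ (suc k′))) * 𝟙 (does (hook κ (suc k) (suc k′) <? p)))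
        ≡⟨ (∑<-cong L λ k k<L → trans (cong (λ b → 𝟙 b * 𝟙 (does (hook κ (suc k) (suc k′) <? p))) (transpose k)) (cell-window k<L k′<a)) ⟩
      ∑[ k < L ] 𝟙 (W (h k + f k′))  ∎
      where
      open ≡-Reasoning
      transpose : ∀ k → does (k <? colAt κ (suc k′)) ≡ does (k′ <? rowAt κ (suc k))
      transpose k = does-⇔ (mk⇔ (<colAt⇒<rowAt decreasing) (<rowAt⇒<colAt decreasing)) (k <? colAt κ (suc k′)) (k′ <? rowAt κ (suc k))

    open ComplementaryBetaSets N n H F W H-bounded F-bounded F-complement H-closed W-above using (K; H-side; F-side; H-side≡F-side)

    N<K : suc N ≤ K
    N<K = m≤n+m (suc N) n

    skl≡H-side : skl n p κ ≡ H-side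
    skl≡H-side = begin
      skl n p κ
        ≡⟨ skl≡∑ n p κ ⟩
      ∑[ k < L ] (𝟙 (not (H (h k + n))) * smallHooksInRow p κ (suc k))
        ≡⟨ (∑<-cong L λ k k<L → cong (𝟙 (not (H (h k + n))) *_) (trans (row-count k<L) (sym (∑-over-F K N<K (λ y → 𝟙 (W (h k + y))))))) ⟩
      ∑[ k < L ] χ (h k)
        ≡⟨ ∑-over-H K N<K χ ⟨
      ∑[ x < K ] (𝟙 (H x) * χ x)
        ≡⟨ (∑<-cong K λ x _ → 𝟙*[𝟙*∑𝟙*𝟙]≡𝟙∧*∑𝟙∧ K (H x) (not (H (x + n))) F (λ y → W (x + y))) ⟩
      H-side ∎
      where
      open ≡-Reasoning
      χ : ℕ → ℕ
      χ x = 𝟙 (not (H (x + n))) * ∑[ y < K ] (𝟙 (F y) * 𝟙 (W (x + y)))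

    skl-conj≡F-side : skl n p (conj κ) ≡ F-side
    skl-conj≡F-side = begin
      skl n p (conj κ)
        ≡⟨ skl≡∑ n p (conj κ) ⟩
      ∑[ k′ < length (conj κ) ] (𝟙 (not (F (hook (conj κ) (suc k′) 1 + n))) * smallHooksInRow p (conj κ) (suc k′))
        ≡⟨ cong (λ m → ∑[ k′ < m ] (𝟙 (not (F (hook (conj κ) (suc k′) 1 + n))) * smallHooksInRow p (conj κ) (suc k′))) (length-conj a κ₀) ⟩
      ∑[ k′ < a ] (𝟙 (not (F (hook (conj κ) (suc k′) 1 + n))) * smallHooksInRow p (conj κ) (suc k′))
        ≡⟨ (∑<-cong a λ k′ k′<a → cong₂ (λ t s → 𝟙 (not (F (t + n))) * s) (hook-conj decreasing {0} k′<a)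
                                       (trans (column-count k′<a) (sym (∑-over-H K N<K (λ x → 𝟙 (W (x + f k′))))))) ⟩
      ∑[ k′ < a ] χ (f k′)
        ≡⟨ ∑-over-F K N<K χ ⟨
      ∑[ y < K ] (𝟙 (F y) * χ y)
        ≡⟨ (∑<-cong K λ y _ → 𝟙*[𝟙*∑𝟙*𝟙]≡𝟙∧*∑𝟙∧ K (F y) (not (F (y + n))) H (λ x → W (x + y))) ⟩
      F-side ∎
      where
      open ≡-Reasoning
      χ : ℕ → ℕ
      χ y = 𝟙 (not (F (y + n))) * ∑[ x < K ] (𝟙 (H x) * 𝟙 (W (x + y)))

    skl≡skl-conj : skl n p κ ≡ skl n p (conj κ)
    skl≡skl-conj = trans skl≡H-side (trans H-side≡F-side (sym skl-conj≡F-side))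

corollary1p6 : (n p : ℕ) → 0 < n → 0 < p → (κ : List ℕ) → IsPartition κ → IsCore n p κ
             → skl n p κ ≡ skl n p (conj κ)
corollary1p6 n p _ _ []       _           _    = refl
corollary1p6 n p _ _ (a ∷ κ₀) κ-partition core =
  HookSets.SkewLengths.skl≡skl-conj a κ₀ κ-partition n p (λ i j cell → proj₁ (core i j cell))
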